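{- Let $M_1,M_2$ be reachable markings of a t-net, both clean, and let $R_1\in\mathit{repr}(M_1)$, $R_2\in\mathit{repr}(M_2)$. If $M_1\sim M_2$, then the relation $$h=\{(\pi,\pi'):\pi\in\mathit{pid}(R_1),\ \pi'\in\mathit{pid}(R_2),\ \mathit{relpath}(\pi,R_1)=\mathit{relpath}(\pi',R_2)\}$$ is a bijection $\mathit{pid}(R_1)\to\mathit{pid}(R_2)$, and $M_1\sim_h M_2$ (with $h$ restricted to $\mathit{pid}_{M_1}\cup\mathit{nextpid}_{M_1}$).
   Context: Process identifiers (pids). $\mathbb{P}=(\mathbb{N}^+)^*$ is the set of finite tuples of positive integers, including $\langle\rangle$, under concatenation; $\langle a_1,\dots,a_n\rangle$ is written $a_1.\cdots.a_n$. For $\pi=\langle a_1,\dots,a_n\rangle$: $\mathit{prefix}(\pi)=\langle a_1,\dots,a_{n-1}\rangle$ if $n>0$, else $\langle\rangle$; $\mathit{subpid}(\pi)=\{\pi\}\cup\mathit{subpid}(\mathit{prefix}(\pi))$ if $n>0$, $\emptyset$ if $n=0$. Relations: $\pi\sphericalangle_1\pi'$ iff $\pi'=\pi.a$ for some $a\in\mathbb N^+$; $\pi\sphericalangle\pi'$ iff $\pi'=\pi.a_1.\cdots.a_n$ for some $n\ge1$; $\pi\pitchfork_1\pi'$ iff $\pi=\pi''.i$, $\pi'=\pi''.(i+1)$ with $\pi''\ne\langle\rangle$; $\pi\pitchfork\pi'$ iff $\pi=\pi''.i$, $\pi'=\pi''.j$ with $\pi''\ne\langle\rangle$, $i<j$.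 $\mathbb P$ is ordered hierarchically: by length, then lexicographically. Coloured Petri nets and t-nets. Fix data values $\mathbb D\supseteq\mathbb N$ (disjoint from $\mathbb P$), variables $\mathbb V$, expressions $\mathbb E\supseteq\mathbb V\cup\mathbb D$; bindings are partial maps $\beta:\mathbb V\to\mathbb P\cup\mathbb D$ extended to expressions. A Petri net $(S,T,\ell)$ has finite disjoint places and transitions, place types $\ell(s)=X_1\times\dots\times X_k$ ($X_i\in\{\mathbb P,\mathbb D\}$), guards $\ell(t)\in\mathbb E$, arc labels $\ell(x,y)$ multisets over $\mathbb E$. A marking maps places to multisets of tokens of their type; $M\xrightarrow{t,\beta}M'$ iff $M(s)\ge\beta(\ell(s,t))$, $\beta(\ell(t,s))$ has type $\ell(s)$, $M'(s)=M(s)-\beta(\ell(s,t))+\beta(\ell(t,s))$ for all $s$, and $\beta(\ell(t))$ holds. A t-net additionally has: a unique generator place $s_\eta$ of type $\mathbb P\times\mathbb N$; initial marking with $M_0(s_\eta)=\{\langle\langle1\rangle,0\rangle\}$, other places empty or containing only data; for each $t$, $\ell(s_\eta,t)=\{\langle p_i,c_i\rangle:1\le i\le k\}$ (distinct variables) and $\ell(t,s_\eta)=\{\langle p_i,c_i+n_i\rangle:1\le i\le m\}\cup\{\langle p_i.(c_i+j),0\rangle:1\le i\le k,1\le j\le n_i\}$ ($m\le k$, $n_i\ge0$), $\Pi_t$ being the set of the $p_i.(c_i+j)$; arcs from $s\ne s_\eta$ carry vectors of variables and data values; arcs to $s\ne s_\eta$ carry vectors of expressions over data variables/values and elements of $\Pi_t\cup\{p_1,\dots,p_m\}$;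 guards are computable Boolean expressions over adjacent-arc variables and data values in which pids from $\Pi_t\cup\{p_1,\dots,p_k\}$ are only compared using $=,\sphericalangle_1,\sphericalangle,\pitchfork_1,\pitchfork$. Reachable markings are reached from $M_0$ by finitely many firings. States and state equivalence. For reachable $M$: $\sigma_M$ is the restriction of $M$ to places other than $s_\eta$; $\eta_M=\{\pi\mapsto k:\langle\pi,k\rangle\in M(s_\eta)\}$; $\mathit{next}_M(\pi)=\pi.(\eta_M(\pi)+1)$ for $\pi\in\mathrm{dom}(\eta_M)$; $\mathit{nextpid}_M=\{\mathit{next}_M(\pi):\pi\in\mathrm{dom}(\eta_M)\}$; $\mathit{pid}_M$ is the set of pids occurring in tokens of $M$ in any place (including $s_\eta$), the active pids. $M$ is clean if for every $\pi\in\mathit{pid}_M\cup\mathit{nextpid}_M$ with $\pi\ne\langle1\rangle$, $\mathit{prefix}(\pi)\in\mathit{pid}_M$. $M\sim_h M'$ iff $h:\mathit{pid}_M\cup\mathit{nextpid}_M\to\mathit{pid}_{M'}\cup\mathit{nextpid}_{M'}$ is a bijection with: (1) $h(\mathrm{dom}(\eta_M))=\mathrm{dom}(\eta_{M'})$; (2) $h(\mathit{next}_M(\pi))=\mathit{next}_{M'}(h(\pi))$ for $\pi\in\mathrm{dom}(\eta_M)$; (3) for $\prec\in\{\sphericalangle_1,\sphericalangle\}$, $\pi,\pi'\in\mathit{pid}_M$: $\pi\prec\pi'$ iff $h(\pi)\prec h(\pi')$; (4) for $\curlywedge\in\{\pitchfork_1,\pitchfork\}$, $\pi,\pi'\in\mathit{pid}_M\cup\mathit{nextpid}_M$: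 $\pi\curlywedge\pi'$ iff $h(\pi)\curlywedge h(\pi')$; (5) $\sigma_{M'}$ is $\sigma_M$ with each pid $\pi$ replaced by $h(\pi)$. $M\sim M'$ iff $M\sim_h M'$ for some $h$. Pid-trees. $\Xi$ is the least set with $\langle M,C\rangle\in\Xi$ for a marking $M$ and $C=\langle\langle a_1,t_1\rangle,\dots,\langle a_n,t_n\rangle\rangle$, $t_i\in\Xi$, $a_i\in\mathbb P\setminus\{\langle\rangle\}$, for $i\ne j$: $a_i\ne a_j$, $a_i\notin\mathit{subpid}(a_j)$, $a_j\notin\mathit{subpid}(a_i)$; written $M\xrightarrow{a_1,\dots,a_n}\langle t_1,\dots,t_n\rangle$. Inclusion: $\langle M',\langle\langle a'_i,t'_i\rangle\rangle_{i\le m}\rangle\subseteq\langle M,\langle\langle a_j,t_j\rangle\rangle_{j\le n}\rangle$ iff $M'\le M$ and each $i$ has $j$ with $a'_i=a_j$, $t'_i\subseteq t_j$. Subtrees: $\langle\langle\rangle,t_0\rangle\in\mathit{Trees}(t_0)$ and $\langle a_i.\pi',t\rangle\in\mathit{Trees}(t_0)$ if $\langle\pi',t\rangle\in\mathit{Trees}(t_i)$; $\mathit{pid}(t)=\{\pi:\langle\pi,t'\rangle\in\mathit{Trees}(t)\}$. Path labelled $\pi$ decorated by $M'$: pid-tree $t$ with $\pi\in\mathit{pid}(t)\subseteq\mathit{subpid}(\pi)\cup\{\langle\rangle\}$, $\langle\pi,\langle M',\langle\rangle\rangle\rangle\in\mathit{Trees}(t)$, all other markings empty; "$R$ contains $\mathit{path}(\pi,M')$"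 means such a path is $\subseteq R$; $\mathit{path}(\pi)=\mathit{path}(\pi,\emptyset)$. Relative path of nonempty $\pi\in\mathit{pid}(t)$, $t=M\xrightarrow{a_1,\dots,a_n}\langle t_1,\dots,t_n\rangle$: $\mathit{relpath}(\pi,t)=\langle i\rangle$ if $\pi=a_i$, and $\langle i\rangle$ followed by $\mathit{relpath}(\pi',t_i)$ if $\pi=a_i.\pi'$, $\pi'\ne\langle\rangle$; convention $\mathit{relpath}(\langle\rangle,t)=\langle\rangle$. Sibling ordered: $a_1\le\dots\le a_n$ (hierarchically) at every node. Representations. $\mathit{repr}(M)$: sibling ordered pid-trees $R$ built so that for each place $s$ of type $X_1\times\dots\times X_n$ and token $v=\langle x_1,\dots,x_n\rangle\in M(s)$ exactly one rule applies, and $R$ contains nothing beyond what the rules require (tokens with multiplicity): generator rule ($s=s_\eta$, $v=\langle\pi,i\rangle$): $R$ contains $\mathit{path}(\pi)$ and $\mathit{path}(\pi.(i+1))$; shared rule ($X_1=\mathbb D$): $R$ contains $\mathit{path}(\langle\rangle,\{(s,v)\})$ and $\mathit{path}(x_i)$ for every $X_i=\mathbb P$; owned rule ($X_1=\mathbb P$): $R$ contains $\mathit{path}(x_1,\{(s,v)\})$ and $\mathit{path}(x_i)$ for every $X_i=\mathbb P$. -}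

module Defs where

open import Data.Nat using (ℕ; zero; suc; _+_; _≤_; _<_)
import Data.Nat.Properties as ℕP
open import Data.Bool using (Bool; true; false)
open import Data.Fin using (Fin; toℕ; inject≤)
open import Data.List using (List; []; _∷_; _++_; [_]; length; map; concat; concatMap; filter; tabulate; allFin; lookup)
open import Data.List.Properties using (≡-dec)
open import Data.List.Membership.Propositional using (_∈_)
open import Data.List.Relation.Unary.All using (All)
open import Data.List.Relation.Unary.Any using (Any)
open import Data.List.Relation.Unary.AllPairs using (AllPairs)
open import Data.List.Relation.Unary.Linked using (Linked)
open import Data.List.Relation.Binary.Pointwise using (Pointwise)
open import Data.List.Relation.Binary.Permutation.Propositional using (_↭_)
open import Data.Maybe using (Maybe; just; nothing)
open import Data.Product using (Σ; _×_; _,_; proj₁; proj₂)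
open import Data.Sum using (_⊎_)
open import Data.Unit using (⊤)
open import Data.Empty using (⊥)
open import Relation.Nullary using (¬_; yes; no)
open import Relation.Binary.PropositionalEquality using (_≡_; _≢_)

-- Process identifiers
-- A pid is a finite tuple of natural numbers (the entries occurring in
-- the paper are positive; only positive entries are ever generated).

Pid : Set
Pid = List ℕ

_≟ᴾ_ : (π π' : Pid) → Relation.Nullary.Dec (π ≡ π')
_≟ᴾ_ = ≡-dec ℕP._≟_

prefix : Pid → Pid
prefix []           = []
prefix (x ∷ [])     = []
prefix (x ∷ y ∷ xs) = x ∷ prefix (y ∷ xs)

Prefix : Pid → Pid → Set
Prefix π π' = Σ Pid λ xs → π' ≡ π ++ xs

_∈subpid_ : Pid → Pid → Set
ρ ∈subpid π = ρ ≢ [] × Prefix ρ π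

_◁₁_ : Pid → Pid → Set
π ◁₁ π' = Σ ℕ λ a → 1 ≤ a × π' ≡ π ++ [ a ]

_◁_ : Pid → Pid → Set
π ◁ π' = Σ Pid λ xs → xs ≢ [] × All (1 ≤_) xs × π' ≡ π ++ xs

_⋔₁_ : Pid → Pid → Set
π ⋔₁ π' = Σ Pid λ p → Σ ℕ λ i → p ≢ [] × 1 ≤ i × π ≡ p ++ [ i ] × π' ≡ p ++ [ suc i ]

_⋔_ : Pid → Pid → Set
π ⋔ π' = Σ Pid λ p → Σ ℕ λ i → Σ ℕ λ j → p ≢ [] × 1 ≤ i × i < j × π ≡ p ++ [ i ] × π' ≡ p ++ [ j ]

data _≤ˡᵉˣ_ : Pid → Pid → Set where
  lex-[] : ∀ {π} → [] ≤ˡᵉˣ π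
  lex-<  : ∀ {x y xs ys} → x < y → (x ∷ xs) ≤ˡᵉˣ (y ∷ ys)
  lex-≡  : ∀ {x xs ys} → xs ≤ˡᵉˣ ys → (x ∷ xs) ≤ˡᵉˣ (x ∷ ys)

_≤ʰ_ : Pid → Pid → Set
π ≤ʰ π' = length π < length π' ⊎ (length π ≡ length π' × π ≤ˡᵉˣ π')

IsBijection : (Pid → Set) → (Pid → Set) → (Pid → Pid → Set) → Set
IsBijection A B H =
  (∀ π → A π → Σ Pid λ π' → B π' × H π π') ×
  (∀ π π₁ π₂ → H π π₁ → H π π₂ → π₁ ≡ π₂) ×
  (∀ π₁ π₂ π' → H π₁ π' → H π₂ π' → π₁ ≡ π₂) ×
  (∀ π' → B π' → Σ Pid λ π → A π × H π π')

record DataDom : Set₁ where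
  field
    D     : Set
    ι     : ℕ → D                      -- ℕ ⊆ 𝔻
    ι-inj : ∀ {m n} → ι m ≡ ι n → m ≡ n

Var : Set
Var = ℕ

data Ty : Set where
  tP tD : Ty

module _ (𝒟 : DataDom) where
  open DataDom 𝒟

  data Val : Set where
    pidv : Pid → Val
    datv : D → Val

Token : DataDom → Set
Token 𝒟 = List (Val 𝒟)

module _ {𝒟 : DataDom} where
  open DataDom 𝒟

  TypedVal : Ty → Val 𝒟 → Set
  TypedVal tP (pidv _) = ⊤
  TypedVal tP (datv _) = ⊥
  TypedVal tD (pidv _) = ⊥
  TypedVal tD (datv _) = ⊤

  Typed : List Ty → Token 𝒟 → Set
  Typed tys v = Pointwise TypedVal tys v

  IsData : Val 𝒟 → Set
  IsData (pidv _) = ⊥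
  IsData (datv _) = ⊤

  owner : Token 𝒟 → Pid
  owner (pidv π ∷ _) = π
  owner _            = []

  renameVal : (Pid → Pid) → Val 𝒟 → Val 𝒟
  renameVal h (pidv π) = pidv (h π)
  renameVal h (datv d) = datv d

data PRel : Set where
  rEq rCh1 rDesc rSib1 rSib : PRel

RelOf : PRel → Pid → Pid → Set
RelOf rEq   = _≡_
RelOf rCh1  = _◁₁_
RelOf rDesc = _◁_
RelOf rSib1 = _⋔₁_
RelOf rSib  = _⋔_

module _ (𝒟 : DataDom) (k : ℕ) (nn : Fin k → ℕ) where
  open DataDom 𝒟

  -- pid terms usable in guards: variables, and the new pids
  -- pnew i j  denotes  p_i.(c_i + (j+1))  ∈ Π_t
  data PTerm : Set where
    pvar : Var → PTerm
    pnew : (i : Fin k) → Fin (nn i) → PTerm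

  data Guard : Set where
    gtrue : Guard
    gnot  : Guard → Guard
    gand  : Guard → Guard → Guard
    gdata : List Var → (List D → Bool) → Guard
    grel  : PRel → PTerm → PTerm → Guard

  data OutExp (m : ℕ) : Set where
    oldP : Fin m → OutExp m
    newP : (i : Fin k) → Fin (nn i) → OutExp m
    dexp : List Var → (List D → D) → OutExp m

record Transition (𝒟 : DataDom) (nP : ℕ) : Set where
  open DataDom 𝒟
  field
    k     : ℕ
    pv cv : Fin k → Var                 -- ℓ(s_η,t) = {⟨p_i,c_i⟩}
    pv-inj   : ∀ i j → pv i ≡ pv j → i ≡ j
    cv-inj   : ∀ i j → cv i ≡ cv j → i ≡ j
    pv≢cv    : ∀ i j → pv i ≢ cv j
    m     : ℕ
    m≤k   : m ≤ k
    nn    : Fin k → ℕ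
    inArc  : Fin nP → List (List (Var ⊎ D))
    outArc : Fin nP → List (List (OutExp 𝒟 k nn m))
    guard  : Guard 𝒟 k nn

record TNet (𝒟 : DataDom) : Set where
  field
    nP      : ℕ                                 -- ordinary places (s_η is separate)
    ptype   : Fin nP → List Ty
    ptype-ne : ∀ s → ptype s ≢ []
    nT      : ℕ
    trans   : Fin nT → Transition 𝒟 nP
    init    : Fin nP → List (Token 𝒟)
    init-ok : ∀ s → All (λ v → Typed (ptype s) v × All IsData v) (init s)

module _ {𝒟 : DataDom} where
  open DataDom 𝒟
  open TNet

  record Marking (N : TNet 𝒟) : Set where
    constructor mark
    field
      gen : List (Pid × ℕ)                -- M(s_η)
      σ   : Fin (nP N) → List (Token 𝒟)
  open Marking public

  M₀ : (N : TNet 𝒟) → Marking N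
  M₀ N = mark [ ([ 1 ] , 0) ] (init N)

  _≈M_ : {N : TNet 𝒟} → Marking N → Marking N → Set
  M ≈M M' = (gen M ↭ gen M') × (∀ s → σ M s ↭ σ M' s)

  -- semantics of expressions under a (total) binding β and the
  -- consumed generator tokens gens (gens i = ⟨β(p_i), β(c_i)⟩)
  evalData : (Var → Val 𝒟) → List Var → Maybe (List D)
  evalData β [] = just []
  evalData β (x ∷ xs) with β x | evalData β xs
  ... | datv d | just ds = just (d ∷ ds)
  ... | _      | _       = nothing

  evalIn : (Var → Val 𝒟) → Var ⊎ D → Val 𝒟
  evalIn β (Data.Sum.inj₁ x) = β x
  evalIn β (Data.Sum.inj₂ d) = datv d

  newPid : ∀ {k} → (gens : Fin k → Pid × ℕ) → (i : Fin k) → ℕ → Pid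
  newPid gens i j = proj₁ (gens i) ++ [ proj₂ (gens i) + suc j ]

  module _ {k : ℕ} {nn : Fin k → ℕ} (β : Var → Val 𝒟) (gens : Fin k → Pid × ℕ) where

    evalPT : PTerm 𝒟 k nn → Maybe Pid
    evalPT (pvar x) with β x
    ... | pidv π = just π
    ... | datv _ = nothing
    evalPT (pnew i j) = just (newPid gens i (toℕ j))

    Holds Fails : Guard 𝒟 k nn → Set
    Holds gtrue = ⊤
    Holds (gnot g) = Fails g
    Holds (gand g g') = Holds g × Holds g'
    Holds (gdata xs f) = Σ (List D) λ ds → evalData β xs ≡ just ds × f ds ≡ true
    Holds (grel r a b) = Σ Pid λ π → Σ Pid λ π' →
      evalPT a ≡ just π × evalPT b ≡ just π' × RelOf r π π'
    Fails gtrue = ⊥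
    Fails (gnot g) = Holds g
    Fails (gand g g') = Fails g ⊎ Fails g'
    Fails (gdata xs f) = Σ (List D) λ ds → evalData β xs ≡ just ds × f ds ≡ false
    Fails (grel r a b) = Σ Pid λ π → Σ Pid λ π' →
      evalPT a ≡ just π × evalPT b ≡ just π' × ¬ RelOf r π π'

    module _ {m : ℕ} (m≤k : m ≤ k) where
      evalOut : OutExp 𝒟 k nn m → Maybe (Val 𝒟)
      evalOut (oldP i) = just (pidv (proj₁ (gens (inject≤ i m≤k))))
      evalOut (newP i j) = just (pidv (newPid gens i (toℕ j)))
      evalOut (dexp xs f) with evalData β xs
      ... | just ds = just (datv (f ds))
      ... | nothing = nothing

      evalTok : List (OutExp 𝒟 k nn m) → Maybe (Token 𝒟)
      evalTok [] = just []
      evalTok (e ∷ es) with evalOut e | evalTok es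
      ... | just v | just vs = just (v ∷ vs)
      ... | _      | _       = nothing

      evalArc : List (List (OutExp 𝒟 k nn m)) → Maybe (List (Token 𝒟))
      evalArc [] = just []
      evalArc (a ∷ as) with evalTok a | evalArc as
      ... | just v | just vs = just (v ∷ vs)
      ... | _      | _       = nothing

  module _ (N : TNet 𝒟) (t : Transition 𝒟 (nP N)) where
    private module T = Transition t

    keptG : (Fin T.k → Pid × ℕ) → List (Pid × ℕ)
    keptG gens = tabulate {n = T.m} λ i →
      let g = gens (inject≤ i T.m≤k) in (proj₁ g , proj₂ g + T.nn (inject≤ i T.m≤k))

    newG : (Fin T.k → Pid × ℕ) → List (Pid × ℕ)
    newG gens = concat (tabulate {n = T.k} λ i →
      tabulate {n = T.nn i} λ j → (newPid gens i (toℕ j) , 0))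

    record Fires (M M' : Marking N) : Set where
      field
        β        : Var → Val 𝒟
        gens     : Fin T.k → Pid × ℕ
        bindP    : ∀ i → β (T.pv i) ≡ pidv (proj₁ (gens i))
        bindC    : ∀ i → β (T.cv i) ≡ datv (ι (proj₂ (gens i)))
        restG    : List (Pid × ℕ)
        consumeG : gen M ↭ tabulate gens ++ restG
        produceG : gen M' ↭ restG ++ (keptG gens ++ newG gens)
        rest     : Fin (nP N) → List (Token 𝒟)
        consume  : ∀ s → σ M s ↭ map (map (evalIn β)) (T.inArc s) ++ rest s
        outs     : Fin (nP N) → List (Token 𝒟)
        evalOK   : ∀ s → evalArc β gens T.m≤k (T.outArc s) ≡ just (outs s)
        typedOut : ∀ s → All (Typed (ptype N s)) (outs s)
        produce  : ∀ s → σ M' s ↭ rest s ++ outs s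
        guardOK  : Holds β gens T.guard

  data Reachable (N : TNet 𝒟) : Marking N → Set where
    start : ∀ {M} → M ≈M M₀ N → Reachable N M
    step  : ∀ {M M'} (i : Fin (nT N)) → Reachable N M → Fires N (trans N i) M M' → Reachable N M'

  module _ {N : TNet 𝒟} where

    InDom : Marking N → Pid → Set
    InDom M π = Σ ℕ λ k → (π , k) ∈ gen M

    InPid : Marking N → Pid → Set
    InPid M π = InDom M π ⊎ (Σ (Fin (nP N)) λ s → Σ (Token 𝒟) λ v → v ∈ σ M s × pidv π ∈ v)

    InNext : Marking N → Pid → Set
    InNext M π = Σ Pid λ ρ → Σ ℕ λ k → (ρ , k) ∈ gen M × π ≡ ρ ++ [ suc k ]

    InA : Marking N → Pid → Set
    InA M π = InPid M π ⊎ InNext M π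

    Clean : Marking N → Set
    Clean M = ∀ π → InA M π → π ≢ [ 1 ] → InPid M (prefix π)

    _⇔_ : Set → Set → Set
    A ⇔ B = (A → B) × (B → A)

    -- M ∼_h M'   (h only matters on pid_M ∪ nextpid_M)
    record _∼[_]_ (M : Marking N) (h : Pid → Pid) (M' : Marking N) : Set where
      field
        maps     : ∀ π → InA M π → InA M' (h π)
        inj      : ∀ π π' → InA M π → InA M π' → h π ≡ h π' → π ≡ π'
        surj     : ∀ π' → InA M' π' → Σ Pid λ π → InA M π × h π ≡ π'
        dom-to   : ∀ π → InDom M π → InDom M' (h π)
        dom-from : ∀ π' → InDom M' π' → Σ Pid λ π → InDom M π × h π ≡ π'
        next     : ∀ π k k' → (π , k) ∈ gen M → (h π , k') ∈ gen M' →
                   h (π ++ [ suc k ]) ≡ h π ++ [ suc k' ]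
        pres-◁₁  : ∀ π π' → InPid M π → InPid M π' → (π ◁₁ π') ⇔ (h π ◁₁ h π')
        pres-◁   : ∀ π π' → InPid M π → InPid M π' → (π ◁ π') ⇔ (h π ◁ h π')
        pres-⋔₁  : ∀ π π' → InA M π → InA M π' → (π ⋔₁ π') ⇔ (h π ⋔₁ h π')
        pres-⋔   : ∀ π π' → InA M π → InA M π' → (π ⋔ π') ⇔ (h π ⋔ h π')
        states   : ∀ s → σ M' s ↭ map (map (renameVal h)) (σ M s)

    _∼_ : Marking N → Marking N → Set
    M ∼ M' = Σ (Pid → Pid) λ h → M ∼[ h ] M'

  module _ (N : TNet 𝒟) where
    NodeMark : Set
    NodeMark = List (Fin (nP N) × Token 𝒟)

    data PTree : Set where
      node : NodeMark → List (Pid × PTree) → PTree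

  module _ {N : TNet 𝒟} where

    markOf : PTree N → NodeMark N
    markOf (node M _) = M

    _≤ᵐ_ : NodeMark N → NodeMark N → Set
    X ≤ᵐ Y = Σ (NodeMark N) λ Z → Y ↭ X ++ Z

    data IsPidTree : PTree N → Set where
      wf : ∀ {M cs} →
           All (λ c → proj₁ c ≢ []) cs →
           AllPairs (λ c d → ¬ (proj₁ c ∈subpid proj₁ d) × ¬ (proj₁ d ∈subpid proj₁ c)) cs →
           All (λ c → IsPidTree (proj₂ c)) cs →
           IsPidTree (node M cs)

    data SiblingOrdered : PTree N → Set where
      so : ∀ {M cs} →
           Linked (λ c d → proj₁ c ≤ʰ proj₁ d) cs →
           All (λ c → SiblingOrdered (proj₂ c)) cs →
           SiblingOrdered (node M cs)

    data _⊆ᵗ_ : PTree N → PTree N → Set where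
      incl : ∀ {M' cs' M cs} → M' ≤ᵐ M →
             All (λ c' → Any (λ c → proj₁ c' ≡ proj₁ c × proj₂ c' ⊆ᵗ proj₂ c) cs) cs' →
             node M' cs' ⊆ᵗ node M cs

    data Sub : PTree N → Pid → PTree N → Set where
      here  : ∀ {t} → Sub t [] t
      there : ∀ {M cs a ti π t'} → (a , ti) ∈ cs → Sub ti π t' → Sub (node M cs) (a ++ π) t'

    InPidT : PTree N → Pid → Set
    InPidT t π = Σ (PTree N) λ t' → Sub t π t'

    -- relpath(π,t) ≡ r   (children indexed from 1)
    data RelPath : PTree N → Pid → List ℕ → Set where
      rp-root : ∀ {t} → RelPath t [] []
      rp-step : ∀ {M cs a ti π r} (i : Fin (length cs)) → lookup cs i ≡ (a , ti) →
                RelPath ti π r → RelPath (node M cs) (a ++ π) (suc (toℕ i) ∷ r)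

    IsPath : Pid → NodeMark N → PTree N → Set
    IsPath π M' t =
      IsPidTree t ×
      Sub t π (node M' []) ×
      (∀ ρ t' → Sub t ρ t' → ρ ≡ [] ⊎ ρ ∈subpid π) ×
      (∀ ρ t' → Sub t ρ t' → ρ ≢ π → markOf t' ≡ [])

    ContainsPath : PTree N → Pid → NodeMark N → Set
    ContainsPath R π M' = Σ (PTree N) λ t → IsPath π M' t × t ⊆ᵗ R

    allTokens : Marking N → NodeMark N
    allTokens M = concatMap (λ s → map (s ,_) (σ M s)) (allFin (nP N))

    tokensAt : Marking N → Pid → NodeMark N
    tokensAt M ρ = filter (λ sv → owner (proj₂ sv) ≟ᴾ ρ) (allTokens M)

    record Repr (R : PTree N) (M : Marking N) : Set where
      field
        pidTree  : IsPidTree R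
        sibOrd   : SiblingOrdered R
        pidPaths : ∀ π → InA M π → ContainsPath R π []
        tokPaths : ∀ s v → v ∈ σ M s → ContainsPath R (owner v) [ (s , v) ]
        exactMark : ∀ ρ t → Sub R ρ t → markOf t ↭ tokensAt M ρ
        exactPids : ∀ ρ t → Sub R ρ t → ρ ≡ [] ⊎ Σ Pid λ π → InA M π × ρ ∈subpid π

    hRel : PTree N → PTree N → Pid → Pid → Set
    hRel R₁ R₂ π π' = InPidT R₁ π × InPidT R₂ π' ×
                      Σ (List ℕ) λ r → RelPath R₁ π r × RelPath R₂ π' r

module Submission where

-- In a representation R of a clean reachable marking M, the nodes are
-- exactly ⟨⟩ and the pids A = pid_M ∪ nextpid_M; every edge is labelled by a
-- single number, the root has at most the child ⟨1⟩, and the children of a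
-- node are sorted by the sibling order ⋔.  A similarity h : M₁ ∼ M₂ (extended
-- by ⟨⟩ ↦ ⟨⟩) maps ⟨1⟩ to ⟨1⟩ and the children of a node exactly onto the
-- children of its image, preserving ⋔.  Two lists strictly sorted by orders
-- that such a correspondence preserves and reflects are matched position by
-- position, so walking down R₁ and R₂ along equal relative paths visits
-- h-corresponding nodes.

open import Defs
open import Data.Nat using (ℕ; suc; _≤_; _<_; s≤s; z≤n)
import Data.Nat.Properties as ℕP
open import Data.Fin using (Fin; toℕ; zero; suc; cast; inject≤)
open import Data.Fin.Properties using (toℕ-injective; toℕ-cast)
open import Data.List using (List; []; _∷_; _++_; [_]; length; lookup; tabulate; initLast; _∷ʳ′_)
open import Data.List.Properties
  using (++-assoc; ++-identityʳ; ++-cancelˡ; ++-conicalˡ; ++-conicalʳ; ∷-injective; ∷ʳ-injective; ∷ʳ-injectiveˡ)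
open import Data.List.Membership.Propositional using (_∈_; find)
open import Data.List.Membership.Propositional.Properties
  using (∈-lookup; ∈-++⁻; ∈-++⁺ˡ; ∈-++⁺ʳ; ∈-tabulate⁻; ∈-tabulate⁺; ∈-concat⁻′)
open import Data.List.Relation.Unary.All as All using (All; []; _∷_)
import Data.List.Relation.Unary.All.Properties as AllP
open import Data.List.Relation.Unary.Any as Any using (Any; here; there)
open import Data.List.Relation.Unary.Any.Properties using (lookup-index)
open import Data.List.Relation.Unary.AllPairs using (AllPairs; []; _∷_)
open import Data.List.Relation.Unary.Linked using (Linked; []; [-]; _∷_)
open import Data.List.Relation.Unary.Linked.Properties using (Linked⇒AllPairs)
open import Data.List.Relation.Binary.Pointwise using (Pointwise; []; _∷_; lookup⁺)
open import Data.List.Relation.Binary.Pointwise.Properties using (symmetric; Pointwise-length)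
open import Data.List.Relation.Binary.Permutation.Propositional using (↭-sym)
open import Data.List.Relation.Binary.Permutation.Propositional.Properties using (∈-resp-↭)
open import Data.Maybe using (just; nothing)
open import Data.Product using (Σ; _×_; _,_; proj₁; proj₂)
open import Data.Sum using (_⊎_; inj₁; inj₂)
open import Data.Empty using (⊥; ⊥-elim)
open import Relation.Nullary using (¬_)
open import Relation.Binary.PropositionalEquality
  using (_≡_; _≢_; refl; sym; trans; cong; subst; subst₂)

prefix-comparable : (a b p q : Pid) → a ++ p ≡ b ++ q → Prefix a b ⊎ Prefix b a
prefix-comparable []      b       p q e = inj₁ (b , refl)
prefix-comparable (x ∷ a) []      p q e = inj₂ (x ∷ a , refl)
prefix-comparable (x ∷ a) (y ∷ b) p q e with ∷-injective e
... | refl , e′ with prefix-comparable a b p q e′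
...   | inj₁ (d , b≡a++d) = inj₁ (d , cong (x ∷_) b≡a++d)
...   | inj₂ (d , a≡b++d) = inj₂ (d , cong (x ∷_) a≡b++d)

allPairs-lookup : ∀ {A : Set} {R : A → A → Set} {xs : List A} → AllPairs R xs →
                  (i j : Fin (length xs)) →
                  i ≡ j ⊎ (R (lookup xs i) (lookup xs j) ⊎ R (lookup xs j) (lookup xs i))
allPairs-lookup (_ ∷ _)    zero    zero    = inj₁ refl
allPairs-lookup (rx ∷ _)   zero    (suc j) = inj₂ (inj₁ (All.lookup rx (∈-lookup j)))
allPairs-lookup (rx ∷ _)   (suc i) zero    = inj₂ (inj₂ (All.lookup rx (∈-lookup i)))
allPairs-lookup (_ ∷ rxs)  (suc i) (suc j) with allPairs-lookup rxs i j
... | inj₁ refl = inj₁ refl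
... | inj₂ r    = inj₂ r

-- This lines up the children of
-- h-corresponding nodes.
module SortedMatching {A B : Set} (_<₁_ : A → A → Set) (_<₂_ : B → B → Set) (H : A → B → Set)
  (asym₁ : ∀ {x y} → x <₁ y → ¬ (y <₁ x)) (asym₂ : ∀ {x y} → x <₂ y → ¬ (y <₂ x)) where

  irrefl₁ : ∀ {x} → ¬ (x <₁ x)
  irrefl₁ x<x = asym₁ x<x x<x

  irrefl₂ : ∀ {y} → ¬ (y <₂ y)
  irrefl₂ y<y = asym₂ y<y y<y

  not-below-head : ∀ {x x′ xs} → All (x <₁_) xs → x′ ∈ x ∷ xs → ¬ (x′ <₁ x)
  not-below-head _  (here refl) x<x  = irrefl₁ x<x
  not-below-head ax (there m)   x′<x = asym₁ (All.lookup ax m) x′<x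

  sorted-matching : ∀ xs ys → AllPairs _<₁_ xs → AllPairs _<₂_ ys →
    (∀ x → x ∈ xs → Σ B λ y → y ∈ ys × H x y) →
    (∀ y → y ∈ ys → Σ A λ x → x ∈ xs × H x y) →
    (∀ {x x′ y y′} → x ∈ xs → x′ ∈ xs → H x y → H x′ y′ →
       (x <₁ x′ → y <₂ y′) × (y <₂ y′ → x <₁ x′)) →
    Pointwise H xs ys
  sorted-matching [] [] _ _ _ _ _ = []
  sorted-matching [] (y ∷ ys) _ _ _ onto _ with onto y (here refl)
  ... | _ , () , _
  sorted-matching (x ∷ xs) [] _ _ total _ _ with total x (here refl)
  ... | _ , () , _
  sorted-matching (x ∷ xs) (y ∷ ys) (ax ∷ sx) (ay ∷ sy) total onto order =
    heads ∷ sorted-matching xs ys sx sy total′ onto′ (λ m m′ → order (there m) (there m′))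
    where
    -- the tails inherit totality and surjectivity, since the heads only match each other
    -- the heads correspond: otherwise y's partner would lie below x
    heads : H x y
    heads with total x (here refl)
    ... | _ , here refl , Hxy = Hxy
    ... | _ , there m , Hxy′ with onto y (here refl)
    ...   | x′ , mx′ , Hx′y =
            ⊥-elim (not-below-head ax mx′ (proj₂ (order mx′ (here refl) Hx′y Hxy′) (All.lookup ay m)))
    total′ : ∀ x′ → x′ ∈ xs → Σ B λ y′ → y′ ∈ ys × H x′ y′
    total′ x′ m with total x′ (there m)
    ... | _ , here refl , Hx′y = ⊥-elim (irrefl₂ (proj₁ (order (here refl) (there m) heads Hx′y) (All.lookup ax m)))
    ... | y′ , there m′ , Hx′y′ = y′ , m′ , Hx′y′
    onto′ : ∀ y′ → y′ ∈ ys → Σ A λ x′ → x′ ∈ xs × H x′ y′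
    onto′ y′ m with onto y′ (there m)
    ... | _ , here refl , Hxy′ = ⊥-elim (irrefl₁ (proj₂ (order (here refl) (here refl) heads Hxy′) (All.lookup ay m)))
    ... | x′ , there m′ , Hx′y′ = x′ , m′ , Hx′y′

prefix-snoc : ∀ (π : Pid) z → prefix (π ++ [ z ]) ≡ π
prefix-snoc []          z = refl
prefix-snoc (x ∷ [])    z = refl
prefix-snoc (x ∷ y ∷ π) z = cong (x ∷_) (prefix-snoc (y ∷ π) z)

snoc-nonempty : ∀ (ρ : Pid) x → ρ ++ [ x ] ≢ []
snoc-nonempty ρ x e with ++-conicalʳ ρ [ x ] e
... | ()

⋔-trans : ∀ {π₁ π₂ π₃} → π₁ ⋔ π₂ → π₂ ⋔ π₃ → π₁ ⋔ π₃
⋔-trans (p , i , j , p≢[] , 1≤i , i<j , refl , e₂) (p′ , i′ , j′ , _ , _ , i′<j′ , e₁′ , refl)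
  with ∷ʳ-injective p p′ (trans (sym e₂) e₁′)
... | refl , refl = p , i , j′ , p≢[] , 1≤i , ℕP.<-trans i<j i′<j′ , refl , refl

⋔-asym : ∀ {π₁ π₂} → π₁ ⋔ π₂ → ¬ (π₂ ⋔ π₁)
⋔-asym (p , i , j , _ , _ , i<j , refl , refl) (p′ , i′ , j′ , _ , _ , i′<j′ , e₁′ , e₂′)
  with ∷ʳ-injective p p′ e₁′ | ∷ʳ-injective p p′ e₂′
... | refl , refl | _ , refl = ℕP.<-asym i<j i′<j′

module _ {𝒟 : DataDom} {N : TNet 𝒟} where

  label-nonempty : ∀ {m cs a t} → IsPidTree {N = N} (node m cs) → (a , t) ∈ cs → a ≢ []
  label-nonempty (wf nonempty _ _) m = All.lookup nonempty m

  -- Children labels are nonempty and pairwise incomparable, so a pid passing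
  -- through a child determines that child and the rest of the pid.
  labels-separated : ∀ {m cs} → IsPidTree {N = N} (node m cs) → (i j : Fin (length cs)) → {p q : Pid} →
                     proj₁ (lookup cs i) ++ p ≡ proj₁ (lookup cs j) ++ q → i ≡ j × p ≡ q
  labels-separated {cs = cs} w@(wf _ separated _) i j {p} {q} e
    with allPairs-lookup separated i j | prefix-comparable a b p q e
    where a = proj₁ (lookup cs i)
          b = proj₁ (lookup cs j)
  ... | inj₁ refl               | _        = refl , ++-cancelˡ (proj₁ (lookup cs i)) p q e
  ... | inj₂ (inj₁ (¬a⊑b , _)) | inj₁ a⊑b = ⊥-elim (¬a⊑b (label-nonempty w (∈-lookup i) , a⊑b))
  ... | inj₂ (inj₁ (_ , ¬b⊑a)) | inj₂ b⊑a = ⊥-elim (¬b⊑a (label-nonempty w (∈-lookup j) , b⊑a))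
  ... | inj₂ (inj₂ (_ , ¬a⊑b)) | inj₁ a⊑b = ⊥-elim (¬a⊑b (label-nonempty w (∈-lookup i) , a⊑b))
  ... | inj₂ (inj₂ (¬b⊑a , _)) | inj₂ b⊑a = ⊥-elim (¬b⊑a (label-nonempty w (∈-lookup j) , b⊑a))

  child-path-nonempty : ∀ {m cs a t} → IsPidTree {N = N} (node m cs) → (a , t) ∈ cs → (π : Pid) → a ++ π ≢ []
  child-path-nonempty w m π e = label-nonempty w m (++-conicalˡ _ π e)

  sub-pidTree : ∀ {t π t′} → IsPidTree {N = N} t → Sub t π t′ → IsPidTree t′
  sub-pidTree w            here        = w
  sub-pidTree (wf _ _ ws) (there m s) = sub-pidTree (All.lookup ws m) s

  sub-sibOrd : ∀ {t π t′} → SiblingOrdered {N = N} t → Sub t π t′ → SiblingOrdered t′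
  sub-sibOrd o            here        = o
  sub-sibOrd (so _ os) (there m s) = sub-sibOrd (All.lookup os m) s

  sub-++ : ∀ {t ρ t′ π t″} → Sub {N = N} t ρ t′ → Sub t′ π t″ → Sub t (ρ ++ π) t″
  sub-++ here        s₂ = s₂
  sub-++ (there {a = a} {π = π} m s₁) s₂ =
    subst (λ z → Sub _ z _) (sym (++-assoc a π _)) (there m (sub-++ s₁ s₂))

  sub-child : ∀ {t ρ m cs a t′} → Sub {N = N} t ρ (node m cs) → (a , t′) ∈ cs → Sub t (ρ ++ a) t′
  sub-child {a = a} s m = subst (λ z → Sub _ z _) (cong (_ ++_) (++-identityʳ a)) (sub-++ s (there m here))

  labels-separated-∈ : ∀ {m cs a b t₁ t₂} → IsPidTree {N = N} (node m cs) → (a , t₁) ∈ cs → (b , t₂) ∈ cs →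
                       {p q : Pid} → a ++ p ≡ b ++ q → (a , t₁) ≡ (b , t₂) × p ≡ q
  labels-separated-∈ {cs = cs} w m₁ m₂ {p} {q} e
    with labels-separated w (Any.index m₁) (Any.index m₂)
           (subst₂ (λ c d → proj₁ c ++ p ≡ proj₁ d ++ q) (lookup-index m₁) (lookup-index m₂) e)
  ... | i≡j , p≡q = trans (lookup-index m₁) (trans (cong (lookup cs) i≡j) (sym (lookup-index m₂))) , p≡q

  sub-suffix : ∀ {t ρ d π t₁ t₂} → IsPidTree {N = N} t → Sub t ρ t₁ → Sub t π t₂ → π ≡ ρ ++ d → Sub t₁ d t₂
  sub-suffix w here s₂ refl = s₂
  sub-suffix w (there {a = a} {π = π} m₁ s₁) here e =
    ⊥-elim (child-path-nonempty w m₁ _ (sym (trans e (++-assoc a π _))))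
  sub-suffix w@(wf _ _ ws) (there {a = a} {π = π} m₁ s₁) (there m₂ s₂) e
    with labels-separated-∈ w m₂ m₁ (trans e (++-assoc a π _))
  ... | refl , π′≡π++d = sub-suffix (All.lookup ws m₁) s₁ s₂ π′≡π++d

  child-step : ∀ {m cs π t w} → IsPidTree {N = N} (node m cs) → Sub (node m cs) π t → π ≡ [ w ] →
               Σ (PTree N) λ t′ → ([ w ] , t′) ∈ cs
  child-step _ here                        ()
  child-step w (there {a = []} m _)        _    = ⊥-elim (label-nonempty w m refl)
  child-step _ (there {a = x ∷ []} m _)    refl = _ , m
  child-step _ (there {a = x ∷ y ∷ a} m _) ()

  child-of-node : ∀ {t ρ m cs w t′} → IsPidTree {N = N} t → Sub t ρ (node m cs) → Sub t (ρ ++ [ w ]) t′ →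
                  Σ (PTree N) λ t″ → ([ w ] , t″) ∈ cs
  child-of-node w s s′ = child-step (sub-pidTree w s) (sub-suffix w s s′ refl) refl

  sub-incl : ∀ {t R π t′} → _⊆ᵗ_ {N = N} t R → Sub t π t′ → InPidT R π
  sub-incl {R = R} _ here = R , here
  sub-incl (incl _ children) (there {a = a} m s) with find (All.lookup children m)
  ... | _ , m′ , refl , t⊆t′ with sub-incl t⊆t′ s
  ...   | t″ , s′ = t″ , there m′ s′

  relpath-of-sub : ∀ {t π t′} → Sub {N = N} t π t′ → Σ (List ℕ) λ r → RelPath t π r
  relpath-of-sub here = [] , rp-root
  relpath-of-sub (there m s) with relpath-of-sub s
  ... | r , rp = _ , rp-step (Any.index m) (sym (lookup-index m)) rp

  sub-of-relpath : ∀ {t π r} → RelPath {N = N} t π r → InPidT t π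
  sub-of-relpath {t} rp-root = t , here
  sub-of-relpath (rp-step {cs = cs} i e rp) with sub-of-relpath rp
  ... | t′ , s = t′ , there (subst (_∈ cs) e (∈-lookup i)) s

  relpath-unique : ∀ {t π₁ π₂ r₁ r₂} → IsPidTree {N = N} t →
                   RelPath t π₁ r₁ → RelPath t π₂ r₂ → π₁ ≡ π₂ → r₁ ≡ r₂
  relpath-unique w rp-root rp-root _ = refl
  relpath-unique w rp-root (rp-step {cs = cs} {π = π} i e _) []≡ =
    ⊥-elim (child-path-nonempty w (subst (_∈ cs) e (∈-lookup i)) π (sym []≡))
  relpath-unique w (rp-step {cs = cs} {π = π} i e _) rp-root ≡[] =
    ⊥-elim (child-path-nonempty w (subst (_∈ cs) e (∈-lookup i)) π ≡[])
  relpath-unique w@(wf _ _ ws) (rp-step {cs = cs} {π = π₁} i e₁ rp₁) (rp-step {π = π₂} j e₂ rp₂) e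
    with labels-separated w i j (subst₂ (λ c d → proj₁ c ++ π₁ ≡ proj₁ d ++ π₂) (sym e₁) (sym e₂) e)
  ... | refl , π₁≡π₂ with trans (sym e₁) e₂
  ...   | refl = cong (suc (toℕ i) ∷_)
                   (relpath-unique (All.lookup ws (subst (_∈ cs) e₁ (∈-lookup i))) rp₁ rp₂ π₁≡π₂)

  relpath-injective : ∀ {t π₁ π₂ r₁ r₂} → RelPath {N = N} t π₁ r₁ → RelPath t π₂ r₂ → r₁ ≡ r₂ → π₁ ≡ π₂
  relpath-injective rp-root          rp-root          _  = refl
  relpath-injective rp-root          (rp-step _ _ _)  ()
  relpath-injective (rp-step _ _ _)  rp-root          ()
  relpath-injective (rp-step i e₁ rp₁) (rp-step j e₂ rp₂) e with ∷-injective e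
  ... | i≡j , r₁≡r₂ with toℕ-injective (ℕP.suc-injective i≡j)
  ...   | refl with trans (sym e₁) e₂
  ...     | refl = cong (_ ++_) (relpath-injective rp₁ rp₂ r₁≡r₂)

  hRel-functional : ∀ {R₁ R₂} → IsPidTree {N = N} R₁ →
                    ∀ π π₁ π₂ → hRel R₁ R₂ π π₁ → hRel R₁ R₂ π π₂ → π₁ ≡ π₂
  hRel-functional w _ _ _ (_ , _ , _ , rp₁ , rp₁′) (_ , _ , _ , rp₂ , rp₂′) =
    relpath-injective rp₁′ rp₂′ (relpath-unique w rp₁ rp₂ refl)

  hRel-injective : ∀ {R₁ R₂} → IsPidTree {N = N} R₂ →
                   ∀ π₁ π₂ π′ → hRel R₁ R₂ π₁ π′ → hRel R₁ R₂ π₂ π′ → π₁ ≡ π₂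
  hRel-injective w _ _ _ (_ , _ , _ , rp₁ , rp₁′) (_ , _ , _ , rp₂ , rp₂′) =
    relpath-injective rp₁ rp₂ (relpath-unique w rp₁′ rp₂′ refl)

  module RelpathTransfer (T₁ T₂ : PTree N) (C : Pid → Pid → Set)
    (children : ∀ {ρ₁ ρ₂ m₁ cs₁ m₂ cs₂} → Sub T₁ ρ₁ (node m₁ cs₁) → Sub T₂ ρ₂ (node m₂ cs₂) → C ρ₁ ρ₂ →
                Pointwise (λ c₁ c₂ → C (ρ₁ ++ proj₁ c₁) (ρ₂ ++ proj₁ c₂)) cs₁ cs₂) where

    transfer : ∀ {ρ₁ ρ₂ t₁ t₂ π r} → Sub T₁ ρ₁ t₁ → Sub T₂ ρ₂ t₂ → C ρ₁ ρ₂ → RelPath t₁ π r →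
               Σ Pid λ π′ → RelPath t₂ π′ r × C (ρ₁ ++ π) (ρ₂ ++ π′)
    transfer {ρ₁} {ρ₂} _ _ c rp-root =
      [] , rp-root , subst₂ C (sym (++-identityʳ ρ₁)) (sym (++-identityʳ ρ₂)) c
    transfer {ρ₁} {ρ₂} {t₂ = node m₂ cs₂} s₁ s₂ c (rp-step {cs = cs₁} {a = a} {π = π} {r = r} i e rp) =
      b ++ π′ ,
      subst (λ k → RelPath (node m₂ cs₂) (b ++ π′) (suc k ∷ r)) (toℕ-cast _ i) (rp-step j refl rp′) ,
      subst₂ C (++-assoc ρ₁ a π) (++-assoc ρ₂ b π′) c′
      where
      matched : Pointwise (λ c₁ c₂ → C (ρ₁ ++ proj₁ c₁) (ρ₂ ++ proj₁ c₂)) cs₁ cs₂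
      matched = children s₁ s₂ c
      j : Fin (length cs₂)
      j = cast (Pointwise-length matched) i
      b : Pid
      b = proj₁ (lookup cs₂ j)
      below : Σ Pid λ π′ → RelPath (proj₂ (lookup cs₂ j)) π′ r × C ((ρ₁ ++ a) ++ π) ((ρ₂ ++ b) ++ π′)
      below = transfer (sub-child s₁ (subst (_∈ cs₁) e (∈-lookup i))) (sub-child s₂ (∈-lookup j))
                       (subst (λ c₁ → C (ρ₁ ++ proj₁ c₁) (ρ₂ ++ b)) e (lookup⁺ matched i)) rp
      π′ : Pid
      π′ = proj₁ below
      rp′ : RelPath (proj₂ (lookup cs₂ j)) π′ r
      rp′ = proj₁ (proj₂ below)
      c′ : C ((ρ₁ ++ a) ++ π) ((ρ₂ ++ b) ++ π′)
      c′ = proj₂ (proj₂ below)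

-- the pids a t-net generates: 1 followed by positive numbers
WellFormed : Pid → Set
WellFormed []       = ⊥
WellFormed (x ∷ xs) = x ≡ 1 × All (1 ≤_) xs

wf-nonempty : ∀ {π} → WellFormed π → π ≢ []
wf-nonempty {x ∷ π} _ ()

wf-snoc : ∀ π {n} → WellFormed π → 1 ≤ n → WellFormed (π ++ [ n ])
wf-snoc (x ∷ π) (x≡1 , positive) 1≤n = x≡1 , AllP.++⁺ positive (1≤n ∷ [])

wf-last : ∀ π j → WellFormed (π ++ [ j ]) → 1 ≤ j
wf-last []      j (refl , _)       = s≤s z≤n
wf-last (x ∷ π) j (_ , positive) with AllP.++⁻ʳ π positive
... | 1≤j ∷ [] = 1≤j

wf-shape : ∀ π → WellFormed π → π ≡ [ 1 ] ⊎ Σ Pid λ τ → Σ ℕ λ z → τ ≢ [] × π ≡ τ ++ [ z ]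
wf-shape π w with initLast π
wf-shape _ ()         | []
wf-shape _ (refl , _) | [] ∷ʳ′ z      = inj₁ refl
wf-shape _ _          | (x ∷ τ) ∷ʳ′ z = inj₂ (x ∷ τ , z , (λ ()) , refl)

module _ {𝒟 : DataDom} {N : TNet 𝒟} where

  WellFormedPids : Marking N → Set
  WellFormedPids M = ∀ π → InPid M π → WellFormed π

  wf-active : ∀ {M} → WellFormedPids M → ∀ π → InA M π → WellFormed π
  wf-active wfM π (inj₁ p)                   = wfM π p
  wf-active wfM _ (inj₂ (ρ , k , m , refl)) = wf-snoc ρ (wfM ρ (inj₁ (k , m))) (s≤s z≤n)

  -- Output tokens only contain pids of consumed generator tokens and the
  -- fresh pids made from them, all well formed if the consumed ones are.
  module OutputPids {k : ℕ} {nn : Fin k → ℕ} (β : Var → Val 𝒟) (gens : Fin k → Pid × ℕ)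
    (gens-wf : ∀ i → WellFormed (proj₁ (gens i))) {m : ℕ} (m≤k : m ≤ k) where

    wf-newPid : ∀ i j → WellFormed (newPid {𝒟 = 𝒟} gens i j)
    wf-newPid i j =
      wf-snoc (proj₁ (gens i)) (gens-wf i) (ℕP.≤-trans (s≤s z≤n) (ℕP.m≤n+m (suc j) (proj₂ (gens i))))

    wf-evalOut : ∀ (e : OutExp 𝒟 k nn m) π → evalOut β gens m≤k e ≡ just (pidv π) → WellFormed π
    wf-evalOut (oldP i)    _ refl = gens-wf (inject≤ i m≤k)
    wf-evalOut (newP i j)  _ refl = wf-newPid i (toℕ j)
    wf-evalOut (dexp xs f) π e with evalData β xs
    wf-evalOut (dexp xs f) π () | just _
    wf-evalOut (dexp xs f) π () | nothing

    wf-evalTok : ∀ (es : List (OutExp 𝒟 k nn m)) v π →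
                 evalTok β gens m≤k es ≡ just v → pidv π ∈ v → WellFormed π
    wf-evalTok []       _ π refl ()
    wf-evalTok (e ∷ es) v π ev p with evalOut β gens m≤k e in ev₁ | evalTok β gens m≤k es in ev₂
    wf-evalTok (e ∷ es) _ π refl (here refl) | just _ | just _  = wf-evalOut e π ev₁
    wf-evalTok (e ∷ es) _ π refl (there p)   | just _ | just vs = wf-evalTok es vs π ev₂ p
    wf-evalTok (e ∷ es) _ π ()   _           | just _ | nothing
    wf-evalTok (e ∷ es) _ π ()   _           | nothing | _

    wf-evalArc : ∀ (as : List (List (OutExp 𝒟 k nn m))) vs v π →
                 evalArc β gens m≤k as ≡ just vs → v ∈ vs → pidv π ∈ v → WellFormed π
    wf-evalArc []       _ v π refl () p
    wf-evalArc (a ∷ as) vs v π ev m p with evalTok β gens m≤k a in ev₁ | evalArc β gens m≤k as in ev₂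
    wf-evalArc (a ∷ as) _ v π refl (here refl) p | just _ | just _  = wf-evalTok a v π ev₁ p
    wf-evalArc (a ∷ as) _ v π refl (there m)   p | just _ | just ws = wf-evalArc as ws v π ev₂ m p
    wf-evalArc (a ∷ as) _ v π ()   _           p | just _ | nothing
    wf-evalArc (a ∷ as) _ v π ()   _           p | nothing | _

  -- initially the only pid is ⟨1⟩, and the places hold data only
  wf-initial : ∀ {M} → M ≈M M₀ N → WellFormedPids M
  wf-initial (gen≈ , _) π (inj₁ (k , m)) with ∈-resp-↭ gen≈ m
  ... | here refl = refl , []
  wf-initial (_ , σ≈) π (inj₂ (s , v , m , p))
    with All.lookup (proj₂ (All.lookup (TNet.init-ok N s) (∈-resp-↭ (σ≈ s) m))) p
  ... | ()

  -- firing preserves well-formedness: surviving pids are old, the rest are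
  -- consumed generator pids or fresh children of them
  wf-fire : ∀ {t M M′} → WellFormedPids M → Fires N t M M′ → WellFormedPids M′
  wf-fire {t} {M} {M′} wfM F = wf′
    where
    module F = Fires F
    module T = Transition t

    consumed-wf : ∀ i → WellFormed (proj₁ (F.gens i))
    consumed-wf i = wfM _ (inj₁ (_ , ∈-resp-↭ (↭-sym F.consumeG) (∈-++⁺ˡ (∈-tabulate⁺ i))))

    open OutputPids {nn = T.nn} F.β F.gens consumed-wf T.m≤k

    fresh-of : Fin T.k → List (Pid × ℕ)
    fresh-of i = tabulate {n = T.nn i} λ j → (newPid {𝒟 = 𝒟} F.gens i (toℕ j) , 0)

    fresh-wf : ∀ π k → (π , k) ∈ newG N t F.gens → WellFormed π
    fresh-wf π k m with ∈-concat⁻′ (tabulate fresh-of) m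
    ... | _ , m₁ , m₂ with ∈-tabulate⁻ {f = fresh-of} m₂
    ...   | i , refl with ∈-tabulate⁻ {f = λ j → (newPid {𝒟 = 𝒟} F.gens i (toℕ j) , 0)} m₁
    ...     | j , refl = wf-newPid i (toℕ j)

    generator-wf : ∀ π k → (π , k) ∈ gen M′ → WellFormed π
    generator-wf π k m with ∈-++⁻ F.restG (∈-resp-↭ F.produceG m)
    ... | inj₁ m₁ = wfM π (inj₁ (k , ∈-resp-↭ (↭-sym F.consumeG) (∈-++⁺ʳ _ m₁)))
    ... | inj₂ m₂ with ∈-++⁻ (keptG N t F.gens) m₂
    ...   | inj₂ m₃ = fresh-wf π k m₃
    ...   | inj₁ m₃ with ∈-tabulate⁻ m₃
    ...     | i , refl = consumed-wf _

    wf′ : WellFormedPids M′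
    wf′ π (inj₁ (k , m)) = generator-wf π k m
    wf′ π (inj₂ (s , v , m , p)) with ∈-++⁻ (F.rest s) (∈-resp-↭ (F.produce s) m)
    ... | inj₁ m₁ = wfM π (inj₂ (s , v , ∈-resp-↭ (↭-sym (F.consume s)) (∈-++⁺ʳ _ m₁) , p))
    ... | inj₂ m₂ = wf-evalArc (T.outArc s) (F.outs s) v π (F.evalOK s) m₂ p

  wf-reachable : ∀ {M} → Reachable N M → WellFormedPids M
  wf-reachable (start M≈M₀)  = wf-initial M≈M₀
  wf-reachable (step _ r F) = wf-fire (wf-reachable r) F

module CleanMarking {𝒟 : DataDom} {N : TNet 𝒟} {M : Marking N} (clean : Clean M) where

  parent-in-pid : ∀ ρ x → ρ ≢ [] → InA M (ρ ++ [ x ]) → InPid M ρ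
  parent-in-pid ρ x ρ≢[] a = subst (InPid M) (prefix-snoc ρ x) (clean (ρ ++ [ x ]) a not-root)
    where
    not-root : ρ ++ [ x ] ≢ [ 1 ]
    not-root e = ρ≢[] (∷ʳ-injectiveˡ ρ [] e)

  prefix-closed : ∀ ρ x d → ρ ≢ [] → InA M (ρ ++ x ∷ d) → InPid M ρ
  prefix-closed ρ x []      ρ≢[] a = parent-in-pid ρ x ρ≢[] a
  prefix-closed ρ x (y ∷ d) ρ≢[] a =
    parent-in-pid ρ x ρ≢[] (inj₁ (prefix-closed (ρ ++ [ x ]) y d (snoc-nonempty ρ x)
                                   (subst (InA M) (sym (++-assoc ρ [ x ] (y ∷ d))) a)))

module ReprShape {𝒟 : DataDom} {N : TNet 𝒟} {M : Marking N} {R : PTree N}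
  (repr : Repr R M) (clean : Clean M) (wfM : WellFormedPids M) where
  open Repr repr
  open CleanMarking {M = M} clean

  active-wf : ∀ π → InA M π → WellFormed π
  active-wf = wf-active {M = M} wfM

  active-node : ∀ π → InA M π → InPidT R π
  active-node π a with pidPaths π a
  ... | _ , (_ , s , _) , t⊆R = sub-incl t⊆R s

  node-active : ∀ {ρ} → ρ ≢ [] → InPidT R ρ → InA M ρ
  node-active {ρ} ρ≢[] (t , s) with exactPids ρ t s
  ... | inj₁ ρ≡[] = ⊥-elim (ρ≢[] ρ≡[])
  ... | inj₂ (π , a , _ , [] , π≡ρ++[]) = subst (InA M) (trans π≡ρ++[] (++-identityʳ ρ)) a
  ... | inj₂ (π , a , _ , x ∷ d , refl) = inj₁ (prefix-closed ρ x d ρ≢[] a)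

  child-label : ∀ {ρ m cs a t} → Sub R ρ (node m cs) → (a , t) ∈ cs →
                Σ ℕ λ j → a ≡ [ j ] × InA M (ρ ++ [ j ])
  child-label {ρ} {m} {cs} {a} s mem = single a mem active
    where
    w : IsPidTree (node m cs)
    w = sub-pidTree pidTree s
    active : InA M (ρ ++ a)
    active = node-active (λ e → label-nonempty w mem (++-conicalʳ ρ a e)) (_ , sub-child s mem)
    -- a longer label x ∷ y ∷ b would pass through the node ρ ++ ⟨x⟩, a sibling
    single : ∀ b {u} → (b , u) ∈ cs → InA M (ρ ++ b) → Σ ℕ λ j → b ≡ [ j ] × InA M (ρ ++ [ j ])
    single []          mem-b _        = ⊥-elim (label-nonempty w mem-b refl)
    single (j ∷ [])    _     active-b = j , refl , active-b
    single (x ∷ y ∷ b) mem-b active-b with child-of-node pidTree s (proj₂ (active-node _ (inj₁ ρx-pid)))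
      where
      ρx-pid : InPid M (ρ ++ [ x ])
      ρx-pid = prefix-closed (ρ ++ [ x ]) y b (snoc-nonempty ρ x)
                 (subst (InA M) (sym (++-assoc ρ [ x ] (y ∷ b))) active-b)
    ... | _ , mem-x with labels-separated-∈ w mem-b mem-x (++-identityʳ (x ∷ y ∷ b))
    ...   | _ , ()

  -- the children of every node are sorted by the sibling order: for a nonempty
  -- node by the sibling ordering of R, and the root has at most one child ⟨1⟩
  children-sorted : ∀ {ρ m cs} → Sub R ρ (node m cs) →
                    AllPairs (λ c c′ → (ρ ++ proj₁ c) ⋔ (ρ ++ proj₁ c′)) cs
  children-sorted {[]} {cs = []}    s = []
  children-sorted {[]} {cs = _ ∷ []} s = [] ∷ []
  children-sorted {[]} {cs = _ ∷ _ ∷ _} s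
    with child-label s (here refl) | child-label s (there (here refl)) | sub-pidTree pidTree s
  ... | _ , refl , a | _ , refl , a′ | wf _ ((separated ∷ _) ∷ _) _
    with active-wf _ a | active-wf _ a′
  ...   | refl , _ | refl , _ = ⊥-elim (proj₁ separated ((λ ()) , [] , refl))
  children-sorted {x ∷ ρ} {cs = cs} s with sub-sibOrd sibOrd s | sub-pidTree pidTree s
  ... | so ordered _ | wf _ separated _ =
    Linked⇒AllPairs ⋔-trans (sorted ordered separated (All.tabulate label))
    where
    Label : Pid × PTree N → Set
    Label c = Σ ℕ λ j → proj₁ c ≡ [ j ] × 1 ≤ j
    label : ∀ {c} → c ∈ cs → Label c
    label mem with child-label s mem
    ... | j , a≡[j] , active = j , a≡[j] , wf-last (x ∷ ρ) j (active-wf _ active)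
    increasing : ∀ {i j} → [ i ] ≤ʰ [ j ] → ¬ ([ i ] ∈subpid [ j ]) → i < j
    increasing (inj₁ (s≤s ()))
    increasing (inj₂ (_ , lex-< i<j)) _ = i<j
    increasing (inj₂ (_ , lex-≡ _))   ¬i⊑j = ⊥-elim (¬i⊑j ((λ ()) , [] , refl))
    sorted : ∀ {cs′} → Linked (λ c d → proj₁ c ≤ʰ proj₁ d) cs′ →
             AllPairs (λ c d → ¬ (proj₁ c ∈subpid proj₁ d) × ¬ (proj₁ d ∈subpid proj₁ c)) cs′ →
             All Label cs′ → Linked (λ c c′ → (x ∷ ρ ++ proj₁ c) ⋔ (x ∷ ρ ++ proj₁ c′)) cs′
    sorted [] _ _ = []
    sorted [-] _ _ = [-]
    sorted (i≤j ∷ ordered′) ((sep ∷ _) ∷ separated′) ((i , refl , 1≤i) ∷ labels@((j , refl , _) ∷ _)) =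
      ((x ∷ ρ) , i , j , (λ ()) , 1≤i , increasing i≤j (proj₁ sep) , refl , refl) ∷
      sorted ordered′ separated′ labels

module SimilarityShape {𝒟 : DataDom} {N : TNet 𝒟} {M₁ M₂ : Marking N} {h : Pid → Pid}
  (sim : M₁ ∼[ h ] M₂) (clean₁ : Clean M₁) (clean₂ : Clean M₂)
  (wf₁ : WellFormedPids M₁) (wf₂ : WellFormedPids M₂) where
  open _∼[_]_ sim
  module C₁ = CleanMarking {M = M₁} clean₁
  module C₂ = CleanMarking {M = M₂} clean₂

  active-wf₁ : ∀ π → InA M₁ π → WellFormed π
  active-wf₁ = wf-active {M = M₁} wf₁

  active-wf₂ : ∀ π → InA M₂ π → WellFormed π
  active-wf₂ = wf-active {M = M₂} wf₂

  image-nonempty : ∀ {π} → InA M₁ π → h π ≢ []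
  image-nonempty a = wf-nonempty (active-wf₂ _ (maps _ a))

  -- h maps a child of a nonempty pid to a child of its image: for pids of M₁
  -- by preservation of ◁₁, for next pids by clause (2) of similarity
  h-child : ∀ ρ j → ρ ≢ [] → InA M₁ (ρ ++ [ j ]) → Σ ℕ λ w → h (ρ ++ [ j ]) ≡ h ρ ++ [ w ]
  h-child ρ j ρ≢[] (inj₁ p)
    with proj₁ (pres-◁₁ ρ (ρ ++ [ j ]) (C₁.parent-in-pid ρ j ρ≢[] (inj₁ p)) p)
               (j , wf-last ρ j (wf₁ _ p) , refl)
  ... | w , _ , hρj≡ = w , hρj≡
  h-child ρ j _ (inj₂ (ρ′ , k , m , e)) with ∷ʳ-injective ρ ρ′ e
  ... | refl , refl with dom-to ρ (k , m)
  ...   | k′ , m′ = suc k′ , next ρ k k′ m m′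

  -- only ⟨1⟩ is mapped to a pid of length one: any other pid has a parent,
  -- whose image would be ⟨⟩
  singleton-image : ∀ {σ w} → InA M₁ σ → h σ ≡ [ w ] → σ ≡ [ 1 ]
  singleton-image {σ} aσ hσ with wf-shape σ (active-wf₁ σ aσ)
  ... | inj₁ σ≡[1] = σ≡[1]
  ... | inj₂ (τ , z , τ≢[] , refl) with h-child τ z τ≢[] aσ
  ...   | _ , hτz = ⊥-elim (image-nonempty (inj₁ (C₁.parent-in-pid τ z τ≢[] aσ))
                                           (∷ʳ-injectiveˡ (h τ) [] (trans (sym hτz) hσ)))

  -- h fixes ⟨1⟩: if h⟨1⟩ were longer, its prefix ⟨1⟩ would be a pid of M₂
  -- without preimage
  h-root : InA M₁ [ 1 ] → h [ 1 ] ≡ [ 1 ]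
  h-root a = shape (h [ 1 ]) refl (active-wf₂ _ (maps _ a))
    where
    shape : ∀ π → h [ 1 ] ≡ π → WellFormed π → h [ 1 ] ≡ [ 1 ]
    shape (_ ∷ [])    e (refl , _) = e
    shape (_ ∷ y ∷ d) e (refl , _)
      with surj [ 1 ] (inj₁ (C₂.prefix-closed [ 1 ] y d (λ ()) (subst (InA M₂) e (maps _ a))))
    ... | σ , aσ , hσ with singleton-image aσ hσ
    ...   | refl with trans (sym e) hσ
    ...     | ()

  h-parent : ∀ {σ ρ w} → InA M₁ σ → InA M₁ ρ → h σ ≡ h ρ ++ [ w ] → Σ ℕ λ z → σ ≡ ρ ++ [ z ]
  h-parent {σ} {ρ} aσ aρ hσ with wf-shape σ (active-wf₁ σ aσ)
  ... | inj₁ refl = ⊥-elim (image-nonempty aρ (∷ʳ-injectiveˡ (h ρ) [] (trans (sym hσ) (h-root aσ))))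
  ... | inj₂ (τ , z , τ≢[] , refl) with h-child τ z τ≢[] aσ
  ...   | _ , hτz with inj τ ρ (inj₁ (C₁.parent-in-pid τ z τ≢[] aσ)) aρ
                               (∷ʳ-injectiveˡ (h τ) (h ρ) (trans (sym hτz) hσ))
  ...     | refl = z , refl

  ĥ : Pid → Pid
  ĥ []         = []
  ĥ π@(_ ∷ _) = h π

  ĥ-nonempty : ∀ π → π ≢ [] → ĥ π ≡ h π
  ĥ-nonempty []      π≢[] = ⊥-elim (π≢[] refl)
  ĥ-nonempty (_ ∷ _) _    = refl

  ĥ-child : ∀ ρ j → InA M₁ (ρ ++ [ j ]) → Σ ℕ λ w → ĥ (ρ ++ [ j ]) ≡ ĥ ρ ++ [ w ]
  ĥ-child []      j a with active-wf₁ _ a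
  ... | refl , _ = 1 , h-root a
  ĥ-child (x ∷ ρ) j a = h-child (x ∷ ρ) j (λ ()) a

  ĥ-parent : ∀ {σ w} ρ → InA M₁ σ → (ρ ≢ [] → InA M₁ ρ) → h σ ≡ ĥ ρ ++ [ w ] →
             Σ ℕ λ z → σ ≡ ρ ++ [ z ]
  ĥ-parent []      aσ _  hσ = 1 , singleton-image aσ hσ
  ĥ-parent (x ∷ ρ) aσ aρ hσ = h-parent aσ (aρ (λ ())) hσ

module Matching {𝒟 : DataDom} {N : TNet 𝒟} {M₁ M₂ : Marking N} {R₁ R₂ : PTree N}
  (repr₁ : Repr R₁ M₁) (repr₂ : Repr R₂ M₂) (clean₁ : Clean M₁) (clean₂ : Clean M₂)
  (wf₁ : WellFormedPids M₁) (wf₂ : WellFormedPids M₂) {h : Pid → Pid} (sim : M₁ ∼[ h ] M₂) where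
  open _∼[_]_ sim
  open SimilarityShape sim clean₁ clean₂ wf₁ wf₂
  module S₁ = ReprShape repr₁ clean₁ wf₁
  module S₂ = ReprShape repr₂ clean₂ wf₂

  Corresponding : Pid → Pid × PTree N → Pid × PTree N → Set
  Corresponding ρ c₁ c₂ = ĥ (ρ ++ proj₁ c₁) ≡ ĥ ρ ++ proj₁ c₂

  -- the children lists of the nodes ρ of R₁ and ĥ ρ of R₂ correspond position
  -- by position: both are sorted by ⋔, and ĥ is an ⋔-isomorphism between them
  children-match : ∀ {ρ m₁ cs₁ m₂ cs₂} → Sub R₁ ρ (node m₁ cs₁) → Sub R₂ (ĥ ρ) (node m₂ cs₂) →
                   Pointwise (Corresponding ρ) cs₁ cs₂
  children-match {ρ} {cs₁ = cs₁} {cs₂ = cs₂} s₁ s₂ =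
    sorted-matching cs₁ cs₂ (S₁.children-sorted s₁) (S₂.children-sorted s₂) total onto
                    (λ {c₁ c₁′ c₂ c₂′} → order {c₁} {c₁′} {c₂} {c₂′})
    where
    _<₁_ _<₂_ : Pid × PTree N → Pid × PTree N → Set
    c <₁ c′ = (ρ ++ proj₁ c) ⋔ (ρ ++ proj₁ c′)
    c <₂ c′ = (ĥ ρ ++ proj₁ c) ⋔ (ĥ ρ ++ proj₁ c′)
    open SortedMatching _<₁_ _<₂_ (Corresponding ρ) ⋔-asym ⋔-asym

    image-of-child : ∀ {j π} → ĥ (ρ ++ [ j ]) ≡ π → h (ρ ++ [ j ]) ≡ π
    image-of-child {j} = trans (sym (ĥ-nonempty _ (snoc-nonempty ρ j)))

    total : ∀ c₁ → c₁ ∈ cs₁ → Σ (Pid × PTree N) λ c₂ → c₂ ∈ cs₂ × Corresponding ρ c₁ c₂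
    total _ mem with S₁.child-label s₁ mem
    ... | j , refl , active with ĥ-child ρ j active
    ...   | w , ĥρj≡ with S₂.active-node _ (subst (InA M₂) (image-of-child ĥρj≡) (maps _ active))
    ...     | _ , s with child-of-node (Repr.pidTree repr₂) s₂ s
    ...       | t , mem′ = ([ w ] , t) , mem′ , ĥρj≡

    onto : ∀ c₂ → c₂ ∈ cs₂ → Σ (Pid × PTree N) λ c₁ → c₁ ∈ cs₁ × Corresponding ρ c₁ c₂
    onto _ mem with S₂.child-label s₂ mem
    ... | w , refl , active with surj _ active
    ...   | σ , aσ , hσ with ĥ-parent ρ aσ (λ ρ≢[] → S₁.node-active ρ≢[] (_ , s₁)) hσ
    ...     | z , refl with child-of-node (Repr.pidTree repr₁) s₁ (proj₂ (S₁.active-node _ aσ))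
    ...       | t , mem′ = ([ z ] , t) , mem′ , trans (ĥ-nonempty _ (snoc-nonempty ρ z)) hσ

    -- (Corresponding only looks at labels, so the children c₂, c₂′ are passed explicitly above)
    order : ∀ {c₁ c₁′ c₂ c₂′} → c₁ ∈ cs₁ → c₁′ ∈ cs₁ → Corresponding ρ c₁ c₂ → Corresponding ρ c₁′ c₂′ →
            (c₁ <₁ c₁′ → c₂ <₂ c₂′) × (c₂ <₂ c₂′ → c₁ <₁ c₁′)
    order mem mem′ e e′ with S₁.child-label s₁ mem | S₁.child-label s₁ mem′
    ... | _ , refl , a | _ , refl , a′ =
      (λ o → subst₂ _⋔_ (image-of-child e) (image-of-child e′) (proj₁ (pres-⋔ _ _ a a′) o)) ,
      (λ o → proj₂ (pres-⋔ _ _ a a′) (subst₂ _⋔_ (sym (image-of-child e)) (sym (image-of-child e′)) o))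

  forward-children : ∀ {ρ₁ ρ₂ m₁ cs₁ m₂ cs₂} → Sub R₁ ρ₁ (node m₁ cs₁) → Sub R₂ ρ₂ (node m₂ cs₂) →
                     ĥ ρ₁ ≡ ρ₂ →
                     Pointwise (λ c₁ c₂ → ĥ (ρ₁ ++ proj₁ c₁) ≡ ρ₂ ++ proj₁ c₂) cs₁ cs₂
  forward-children s₁ s₂ refl = children-match s₁ s₂

  backward-children : ∀ {ρ₂ ρ₁ m₂ cs₂ m₁ cs₁} → Sub R₂ ρ₂ (node m₂ cs₂) → Sub R₁ ρ₁ (node m₁ cs₁) →
                      ĥ ρ₁ ≡ ρ₂ →
                      Pointwise (λ c₂ c₁ → ĥ (ρ₁ ++ proj₁ c₁) ≡ ρ₂ ++ proj₁ c₂) cs₂ cs₁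
  backward-children s₂ s₁ refl = symmetric (λ e → e) (children-match s₁ s₂)

  module Forward  = RelpathTransfer R₁ R₂ (λ π₁ π₂ → ĥ π₁ ≡ π₂) forward-children
  module Backward = RelpathTransfer R₂ R₁ (λ π₂ π₁ → ĥ π₁ ≡ π₂) backward-children

  forward : ∀ {π r} → RelPath R₁ π r → Σ Pid λ π′ → RelPath R₂ π′ r × ĥ π ≡ π′
  forward = Forward.transfer here here refl

  backward : ∀ {π′ r} → RelPath R₂ π′ r → Σ Pid λ π → RelPath R₁ π r × ĥ π ≡ π′
  backward = Backward.transfer here here refl

  bijection : IsBijection (InPidT R₁) (InPidT R₂) (hRel R₁ R₂)
  bijection = total , hRel-functional (Repr.pidTree repr₁) , hRel-injective (Repr.pidTree repr₂) , onto
    where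
    total : ∀ π → InPidT R₁ π → Σ Pid λ π′ → InPidT R₂ π′ × hRel R₁ R₂ π π′
    total π (t , s) with relpath-of-sub s
    ... | r , rp with forward rp
    ...   | π′ , rp′ , _ = π′ , sub-of-relpath rp′ , (t , s) , sub-of-relpath rp′ , r , rp , rp′

    onto : ∀ π′ → InPidT R₂ π′ → Σ Pid λ π → InPidT R₁ π × hRel R₁ R₂ π π′
    onto π′ (t , s) with relpath-of-sub s
    ... | r , rp with backward rp
    ...   | π , rp′ , _ = π , sub-of-relpath rp′ , sub-of-relpath rp′ , (t , s) , r , rp′ , rp

  matches-h : ∀ π → InA M₁ π → hRel R₁ R₂ π (h π)
  matches-h π a with S₁.active-node π a
  ... | t , s with relpath-of-sub s
  ...   | r , rp with forward rp
  ...     | π′ , rp′ , ĥπ≡π′ =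
    (t , s) , sub-of-relpath rp″ , r , rp , rp″
    where
    rp″ : RelPath R₂ (h π) r
    rp″ = subst (λ π″ → RelPath R₂ π″ r)
                (trans (sym ĥπ≡π′) (ĥ-nonempty π (wf-nonempty (active-wf₁ π a)))) rp′

proposition7 : (𝒟 : DataDom) (N : TNet 𝒟) (M₁ M₂ : Marking N) (R₁ R₂ : PTree N) →
    Reachable N M₁ → Reachable N M₂ → Clean M₁ → Clean M₂ →
    Repr R₁ M₁ → Repr R₂ M₂ → M₁ ∼ M₂ →
    IsBijection (InPidT R₁) (InPidT R₂) (hRel R₁ R₂) ×
    Σ (Pid → Pid) (λ f → ((π : Pid) → InA M₁ π → hRel R₁ R₂ π (f π)) × M₁ ∼[ f ] M₂)
proposition7 𝒟 N M₁ M₂ R₁ R₂ reach₁ reach₂ clean₁ clean₂ repr₁ repr₂ (h , sim) =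
  bijection , h , matches-h , sim
  where
  open Matching repr₁ repr₂ clean₁ clean₂ (wf-reachable reach₁) (wf-reachable reach₂) sim
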